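{- For every integer $n\geq 1$, the number of Fishburn permutations of length $n$ that simultaneously avoid the classical patterns $321$, $1423$ and $4123$ equals $F_{n+1}-1$, where $F_n$ is the Fibonacci number defined by $F_0=F_1=1$ and $F_n=F_{n-1}+F_{n-2}$ for $n\geq 2$.
   Context: A permutation of length $n$ is a rearrangement $\pi=\pi_1\cdots\pi_n$ of $[n]$. A permutation $\pi$ contains a classical pattern $p\in S_k$ if some subsequence of $\pi$ of length $k$ is order-isomorphic to $p$; otherwise it avoids $p$. A Fishburn permutation is a permutation $\pi$ for which there are no indices $i<j$ with $\pi_j<\pi_i<\pi_{i+1}$ and $\pi_i=\pi_j+1$. -}

module Defs where

open import Data.Nat using (ℕ; zero; suc; _+_)
open import Data.Fin using (Fin; zero; suc; toℕ; _<_; inject₁)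
open import Data.Vec using (Vec; []; _∷_; lookup)
open import Data.List using (List; length)
open import Data.List.Membership.Propositional using (_∈_)
open import Data.Product using (Σ; ∃; _×_; _,_; proj₁; proj₂)
open import Relation.Nullary using (¬_)
open import Relation.Binary.PropositionalEquality using (_≡_)
open import Data.Unit using (⊤)
open import Data.List.Relation.Unary.Unique.Propositional using (Unique)
open import Function using (_⇔_)

F : ℕ → ℕ
F zero = 1
F (suc zero) = 1
F (suc (suc n)) = F (suc n) + F n

Word : ℕ → Set
Word n = Vec (Fin n) n

-- A permutation of length n: the word is injective (hence a bijection of Fin n).
IsPerm : ∀ {n} → Word n → Set
IsPerm {n} π = ∀ (i j : Fin n) → lookup π i ≡ lookup π j → i ≡ j

Occurrence : ∀ {n k} → Word n → Vec (Fin k) k → Vec (Fin n) k → Set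
Occurrence {n} {k} π p e =
  (∀ (a b : Fin k) → a < b → lookup e a < lookup e b) ×
  (∀ (a b : Fin k) → (lookup p a < lookup p b) ⇔ (lookup π (lookup e a) < lookup π (lookup e b)))

Contains : ∀ {n k} → Word n → Vec (Fin k) k → Set
Contains {n} {k} π p = ∃ λ (e : Vec (Fin n) k) → Occurrence π p e

Avoids : ∀ {n k} → Word n → Vec (Fin k) k → Set
Avoids π p = ¬ Contains π p

-- Fishburn: no indices i < j with π_j < π_i < π_{i+1} and π_i = π_j + 1.
-- (i+1 must be a valid index, so i ranges over positions with a successor.)
IsFishburn : ∀ {n} → Word n → Set
IsFishburn {zero} π = ⊤
IsFishburn {suc n} π =
  ∀ (i : Fin n) (j : Fin (suc n)) →
    ¬ ( (inject₁ i < j)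
      × (lookup π j < lookup π (inject₁ i))
      × (lookup π (inject₁ i) < lookup π (suc i))
      × (toℕ (lookup π (inject₁ i)) ≡ suc (toℕ (lookup π j))) )

-- The patterns (written 0-based: 321 ↦ 210 etc.).
p321 : Vec (Fin 3) 3
p321 = suc (suc zero) ∷ suc zero ∷ zero ∷ []

p1423 : Vec (Fin 4) 4
p1423 = zero ∷ suc (suc (suc zero)) ∷ suc zero ∷ suc (suc zero) ∷ []

p4123 : Vec (Fin 4) 4
p4123 = suc (suc (suc zero)) ∷ zero ∷ suc zero ∷ suc (suc zero) ∷ []

Good : ∀ {n} → Word n → Set
Good π = IsPerm π × IsFishburn π × Avoids π p321 × Avoids π p1423 × Avoids π p4123

HasCount : ∀ {n} → (Word n → Set) → ℕ → Set
HasCount {n} P m =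
  Σ (List (Word n)) λ L → Unique L × (∀ (x : Word n) → (x ∈ L) ⇔ P x) × (length L ≡ m)

{-# OPTIONS --safe #-}
module Submission where

-- Permutations are handled as sequences f : ℕ → ℕ on [0,n). A good permutation either is layered
-- with blocks 1 and 21, i.e. a square/domino tiling of a strip of length n (F n of these), or it
-- starts with a hook 3 1 4 5 ⋯ (k+3) 2 followed by a layered permutation of the remaining entries
-- (F (n-1) - 1 of these over all k), giving F (n+1) - 1. For the converse, read a good permutation
-- from the left while its prefix is a block: the next value exceeds its position by at most two
-- (else a 4123 or a 321), an excess of one forces a block 21 (Fishburn), and an excess of two can
-- only occur at the very start (else a 1423), where 321, 1423 and the Fishburn condition force a hook.

open import Defs
open import Data.Nat using (ℕ; zero; suc; _+_; _∸_; _≤_; _<_; _≥_; z≤n; s≤s; z<s; s<s; _≤?_; _≟_)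
open import Data.Nat.Properties
open import Data.Fin as Fin using (Fin; zero; suc; toℕ; fromℕ<; inject₁; punchOut)
open import Data.Fin.Properties using (toℕ-injective; toℕ-fromℕ<; toℕ<n; toℕ-inject₁; ≤fromℕ; any?; pigeonhole; punchOut-injective)
  renaming (_≟_ to _≟ᶠ_; <-cmp to <-cmpᶠ)
open import Data.Vec using (Vec; []; _∷_; lookup; tabulate)
open import Data.Vec.Properties using (lookup∘tabulate; tabulate∘lookup; tabulate-cong)
open import Data.List using (List; []; _∷_; map; _++_; length)
open import Data.List.Properties using (length-map; length-++)
open import Data.List.Membership.Propositional using (_∈_)
open import Data.List.Membership.Propositional.Properties using (∈-map⁺; ∈-map⁻; ∈-++⁺ˡ; ∈-++⁺ʳ)
open import Data.List.Relation.Unary.Any using (here)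
open import Data.List.Relation.Unary.Unique.Propositional using (Unique)
open import Data.List.Relation.Unary.Unique.Propositional.Properties using (map⁺; ++⁺)
open import Data.List.Relation.Unary.AllPairs using ([]; _∷_)
open import Data.List.Relation.Unary.All using ([])
open import Data.Sum using (_⊎_; inj₁; inj₂; map₂; [_,_]′)
open import Data.Product using (Σ; ∃; _×_; _,_; proj₁; proj₂)
open import Data.Empty using (⊥; ⊥-elim)
open import Relation.Nullary using (¬_; yes; no)
open import Relation.Binary.PropositionalEquality hiding (J)
open import Relation.Binary using (tri<; tri≈; tri>)
open import Function using (_∘_; mk⇔; Equivalence)

punchIn : ℕ → ℕ → ℕ
punchIn zero    x       = suc x
punchIn (suc v) zero    = zero
punchIn (suc v) (suc x) = suc (punchIn v x)

punchIn≢ : ∀ v x → punchIn v x ≢ v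
punchIn≢ (suc v) (suc x) eq = punchIn≢ v x (suc-injective eq)

punchIn-< : ∀ v {x} → x < v → punchIn v x ≡ x
punchIn-< (suc v) {zero}  _         = refl
punchIn-< (suc v) {suc x} (s<s x<v) = cong suc (punchIn-< v x<v)

punchIn≤suc : ∀ v x → punchIn v x ≤ suc x
punchIn≤suc zero    x       = ≤-refl
punchIn≤suc (suc v) zero    = z≤n
punchIn≤suc (suc v) (suc x) = s≤s (punchIn≤suc v x)

punchIn-injective : ∀ v {x y} → punchIn v x ≡ punchIn v y → x ≡ y
punchIn-injective zero    eq = suc-injective eq
punchIn-injective (suc v) {zero}  {zero}  eq = refl
punchIn-injective (suc v) {suc x} {suc y} eq =
  cong suc (punchIn-injective v (suc-injective eq))

punchIn-cancel-< : ∀ v {x y} → punchIn v x < punchIn v y → x < y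
punchIn-cancel-< zero    (s<s x<y) = x<y
punchIn-cancel-< (suc v) {zero}  {suc y} _         = z<s
punchIn-cancel-< (suc v) {suc x} {suc y} (s<s p) = s<s (punchIn-cancel-< v p)

punchIn<⇒< : ∀ v x → punchIn v x < v → x < v
punchIn<⇒< (suc v) zero    _       = z<s
punchIn<⇒< (suc v) (suc x) (s<s p) = s<s (punchIn<⇒< v x p)

<punchIn⇒≤ : ∀ v x → v < punchIn v x → v ≤ x
<punchIn⇒≤ zero    x       _       = z≤n
<punchIn⇒≤ (suc v) (suc x) (s<s p) = s≤s (<punchIn⇒≤ v x p)

punchIn≡0 : ∀ v x → punchIn v x ≡ 0 → x ≡ 0 × v ≢ 0
punchIn≡0 (suc v) zero refl = refl , λ ()

punchIn-adjacent : ∀ v x y → punchIn v x ≡ suc (punchIn v y) → x ≡ suc y × x ≢ v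
punchIn-adjacent zero    x       y       eq = suc-injective eq , λ { refl → punchIn≢ 0 y (sym (suc-injective eq)) }
punchIn-adjacent (suc v) (suc x) zero    eq with punchIn≡0 v x (suc-injective eq)
... | refl , v≢0 = refl , v≢0 ∘ sym ∘ suc-injective
punchIn-adjacent (suc v) (suc x) (suc y) eq with punchIn-adjacent v x y (suc-injective eq)
... | x≡1+y , x≢v = cong suc x≡1+y , x≢v ∘ suc-injective

prepend : ℕ → (ℕ → ℕ) → ℕ → ℕ
prepend v h zero    = v
prepend v h (suc i) = punchIn v (h i)

Bounded : ℕ → (ℕ → ℕ) → Set
Bounded n f = ∀ i → i < n → f i < n

InjectiveOn : ℕ → (ℕ → ℕ) → Set
InjectiveOn n f = ∀ i j → i < n → j < n → f i ≡ f j → i ≡ j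

SurjectiveOn : ℕ → (ℕ → ℕ) → Set
SurjectiveOn n f = ∀ w → w < n → ∃ λ i → i < n × f i ≡ w

-- While a hook is decoded, the only Fishburn occurrences have top value 1 or 2; prepending the
-- next entry destroys them.
FishburnExcept : (ℕ → Set) → ℕ → (ℕ → ℕ) → Set
FishburnExcept P n f =
  ∀ i j → suc i < n → j < n → i < j → f i < f (suc i) → f i ≡ suc (f j) → P (f i)

Fishburn : ℕ → (ℕ → ℕ) → Set
Fishburn = FishburnExcept (λ _ → ⊥)

Avoids321 : ℕ → (ℕ → ℕ) → Set
Avoids321 n f = ∀ a b c → a < b → b < c → c < n → f c < f b → f b < f a → ⊥

Avoids312 : ℕ → (ℕ → ℕ) → Set
Avoids312 n f = ∀ a b c → a < b → b < c → c < n → f b < f c → f c < f a → ⊥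

Avoids1423 : ℕ → (ℕ → ℕ) → Set
Avoids1423 n f = ∀ a b c d → a < b → b < c → c < d → d < n → f a < f c → f c < f d → f d < f b → ⊥

Avoids4123 : ℕ → (ℕ → ℕ) → Set
Avoids4123 n f = ∀ a b c d → a < b → b < c → c < d → d < n → f b < f c → f c < f d → f d < f a → ⊥

avoids312⇒avoids1423 : ∀ {n f} → Avoids312 n f → Avoids1423 n f
avoids312⇒avoids1423 av a b c d _ b<c c<d d<n _ = av b c d b<c c<d d<n

avoids312⇒avoids4123 : ∀ {n f} → Avoids312 n f → Avoids4123 n f
avoids312⇒avoids4123 av a b c d a<b b<c c<d d<n _ = av a c d (<-trans a<b b<c) c<d d<n

module _ {n v : ℕ} {h : ℕ → ℕ} where

  prepend-bounded : v ≤ n → Bounded n h → Bounded (suc n) (prepend v h)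
  prepend-bounded v≤n bd zero    _         = s≤s v≤n
  prepend-bounded v≤n bd (suc i) (s<s i<n) = s≤s (≤-trans (punchIn≤suc v (h i)) (bd i i<n))

  prepend-injective : InjectiveOn n h → InjectiveOn (suc n) (prepend v h)
  prepend-injective inj zero    zero    _         _         _  = refl
  prepend-injective inj zero    (suc j) _         _         eq = ⊥-elim (punchIn≢ v (h j) (sym eq))
  prepend-injective inj (suc i) zero    _         _         eq = ⊥-elim (punchIn≢ v (h i) eq)
  prepend-injective inj (suc i) (suc j) (s<s i<n) (s<s j<n) eq =
    cong suc (inj i j i<n j<n (punchIn-injective v eq))

  prepend-fishburn : ∀ {P} → P v ⊎ v ≡ 0 ⊎ h 0 < v →
                     FishburnExcept (λ x → x ≡ v ⊎ P (punchIn v x)) n h →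
                     FishburnExcept P (suc n) (prepend v h)
  prepend-fishburn (inj₁ Pv)         fish zero    (suc j) _ _ _ _ _ = Pv
  prepend-fishburn (inj₂ (inj₁ refl)) fish zero    (suc j) _ _ _ _ ()
  prepend-fishburn (inj₂ (inj₂ h0<v)) fish zero    (suc j) _ _ _ v<h0 _ =
    ⊥-elim (<-asym h0<v (subst (v <_) (punchIn-< v h0<v) v<h0))
  prepend-fishburn side fish (suc i) (suc j) (s<s 1+i<n) (s<s j<n) (s<s i<j) up adj
    with punchIn-adjacent v (h i) (h j) adj
  ... | adj′ , hi≢v with fish i j 1+i<n j<n i<j (punchIn-cancel-< v up) adj′
  ...   | inj₁ hi≡v = ⊥-elim (hi≢v hi≡v)
  ...   | inj₂ P = P

  prepend-avoids321 : (∀ b c → b < c → c < n → h c < h b → h b < v → ⊥) →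
                      Avoids321 n h → Avoids321 (suc n) (prepend v h)
  prepend-avoids321 new av zero (suc b) (suc c) _ (s<s b<c) (s<s c<n) p q =
    new b c b<c c<n (punchIn-cancel-< v p) (punchIn<⇒< v (h b) q)
  prepend-avoids321 new av (suc a) (suc b) (suc c) (s<s a<b) (s<s b<c) (s<s c<n) p q =
    av a b c a<b b<c c<n (punchIn-cancel-< v p) (punchIn-cancel-< v q)

  prepend-avoids312 : (∀ b c → b < c → c < n → h b < h c → h c < v → ⊥) →
                      Avoids312 n h → Avoids312 (suc n) (prepend v h)
  prepend-avoids312 new av zero (suc b) (suc c) _ (s<s b<c) (s<s c<n) p q =
    new b c b<c c<n (punchIn-cancel-< v p) (punchIn<⇒< v (h c) q)
  prepend-avoids312 new av (suc a) (suc b) (suc c) (s<s a<b) (s<s b<c) (s<s c<n) p q =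
    av a b c a<b b<c c<n (punchIn-cancel-< v p) (punchIn-cancel-< v q)

  prepend-avoids1423 : (∀ b c d → b < c → c < d → d < n → v ≤ h c → h c < h d → h d < h b → ⊥) →
                       Avoids1423 n h → Avoids1423 (suc n) (prepend v h)
  prepend-avoids1423 new av zero (suc b) (suc c) (suc d) _ (s<s b<c) (s<s c<d) (s<s d<n) p q r =
    new b c d b<c c<d d<n (<punchIn⇒≤ v (h c) p) (punchIn-cancel-< v q) (punchIn-cancel-< v r)
  prepend-avoids1423 new av (suc a) (suc b) (suc c) (suc d) (s<s a<b) (s<s b<c) (s<s c<d) (s<s d<n) p q r =
    av a b c d a<b b<c c<d d<n (punchIn-cancel-< v p) (punchIn-cancel-< v q) (punchIn-cancel-< v r)

  prepend-avoids4123 : (∀ b c d → b < c → c < d → d < n → h b < h c → h c < h d → h d < v → ⊥) →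
                       Avoids4123 n h → Avoids4123 (suc n) (prepend v h)
  prepend-avoids4123 new av zero (suc b) (suc c) (suc d) _ (s<s b<c) (s<s c<d) (s<s d<n) p q r =
    new b c d b<c c<d d<n (punchIn-cancel-< v p) (punchIn-cancel-< v q) (punchIn<⇒< v (h d) r)
  prepend-avoids4123 new av (suc a) (suc b) (suc c) (suc d) (s<s a<b) (s<s b<c) (s<s c<d) (s<s d<n) p q r =
    av a b c d a<b b<c c<d d<n (punchIn-cancel-< v p) (punchIn-cancel-< v q) (punchIn-cancel-< v r)

record Admissible (P : ℕ → Set) (n : ℕ) (f : ℕ → ℕ) : Set where
  constructor admissible
  field
    bounded   : Bounded n f
    injective : InjectiveOn n f
    fishburn  : FishburnExcept P n f
    avoids321 : Avoids321 n f
    avoids312 : Avoids312 n f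

record GoodMap (n : ℕ) (f : ℕ → ℕ) : Set where
  constructor goodMap
  field
    bounded    : Bounded n f
    injective  : InjectiveOn n f
    fishburn   : Fishburn n f
    avoids321  : Avoids321 n f
    avoids1423 : Avoids1423 n f
    avoids4123 : Avoids4123 n f

admissible⇒goodMap : ∀ {n f} → Admissible (λ _ → ⊥) n f → GoodMap n f
admissible⇒goodMap (admissible bd inj fish av321 av312) =
  goodMap bd inj fish av321 (avoids312⇒avoids1423 av312) (avoids312⇒avoids4123 av312)

admissible-weaken : ∀ {P Q : ℕ → Set} {n f} → (∀ {x} → P x → Q x) → Admissible P n f → Admissible Q n f
admissible-weaken P⊆Q (admissible bd inj fish av321 av312) =
  admissible bd inj (λ i j a b c d e → P⊆Q (fish i j a b c d e)) av321 av312

admissible-prepend0 : ∀ {Q n h} → Admissible (Q ∘ suc) n h → Admissible Q (suc n) (prepend 0 h)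
admissible-prepend0 {Q} (admissible bd inj fish av321 av312) =
  admissible (prepend-bounded z≤n bd) (prepend-injective inj)
    (prepend-fishburn {P = Q} (inj₂ (inj₁ refl)) (λ i j a b c d e → inj₂ (fish i j a b c d e)))
    (prepend-avoids321 (λ _ _ _ _ _ ()) av321) (prepend-avoids312 (λ _ _ _ _ _ ()) av312)

no-pair-below-1 : ∀ {x y} → x < y → y < 1 → ⊥
no-pair-below-1 x<y (s<s y≤0) = n≮0 (<-≤-trans x<y y≤0)

admissible-prepend1 : ∀ {P n h} → (∀ {x} → P x → x ≡ 1) → P 1 ⊎ h 0 ≡ 0 →
                      Admissible P (suc n) h → Admissible P (suc (suc n)) (prepend 1 h)
admissible-prepend1 {P} {h = h} P⊆1 side (admissible bd inj fish av321 av312) =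
  admissible (prepend-bounded (s≤s z≤n) bd) (prepend-injective inj)
    (prepend-fishburn {P = P} side′ (λ i j a b c d e → inj₁ (P⊆1 (fish i j a b c d e))))
    (prepend-avoids321 (λ _ _ _ _ p q → no-pair-below-1 p q) av321)
    (prepend-avoids312 (λ _ _ _ _ p q → no-pair-below-1 p q) av312)
  where
  side′ : P 1 ⊎ 1 ≡ 0 ⊎ h 0 < 1
  side′ = map₂ (λ h0≡0 → inj₂ (subst (_< 1) (sym h0≡0) z<s)) side

goodMap-prepend2 : ∀ {n X} → X 0 ≡ 0 → Admissible (_≡ 2) (suc (suc n)) X →
                   GoodMap (suc (suc (suc n))) (prepend 2 X)
goodMap-prepend2 {n} {X} X0≡0 (admissible bd inj fish av321 av312) =
  goodMap (prepend-bounded (s≤s (s≤s z≤n)) bd) (prepend-injective inj)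
    (prepend-fishburn {P = λ _ → ⊥} (inj₂ (inj₂ (subst (_< 2) (sym X0≡0) z<s)))
      (λ i j a b c d e → inj₁ (fish i j a b c d e)))
    (prepend-avoids321 no-descent-below-2 av321)
    (prepend-avoids1423 (λ b c d b<c c<d d<n _ → av312 b c d b<c c<d d<n) (avoids312⇒avoids1423 av312))
    (prepend-avoids4123 (λ _ _ _ _ _ _ p q r → no-pair-below-1 p (<-≤-trans q (≤-pred r)))
      (avoids312⇒avoids4123 av312))
  where
  no-descent-below-2 : ∀ b c → b < c → c < suc (suc n) → X c < X b → X b < 2 → ⊥
  no-descent-below-2 b c b<c c<n p q with inj c 0 c<n z<s (trans (n<1⇒n≡0 (<-≤-trans p (≤-pred q))) (sym X0≡0))
  ... | refl = n≮0 b<c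

-- Tilings, hooks and the permutations they encode

-- Squares and dominoes decode to the blocks 1 and 21 of a layered permutation.
data Tiling : ℕ → Set where
  empty  : Tiling 0
  square : ∀ {n} → Tiling n → Tiling (suc n)
  domino : ∀ {n} → Tiling n → Tiling (suc (suc n))

-- decode (hooked (hook k t)) is 3 1 4 5 ⋯ (k+3) 2 followed by the layered permutation of t shifted
-- up by k + 3 (one-line notation, values from 1).
data Hook : ℕ → Set where
  close  : ∀ {n} → Tiling n → Hook n
  extend : ∀ {n} → Hook n → Hook (suc n)

data Shape : ℕ → Set where
  layered : ∀ {n} → Tiling n → Shape n
  hooked  : ∀ {n} → Hook n → Shape (suc (suc (suc n)))

decodeT : ∀ {n} → Tiling n → ℕ → ℕ
decodeT empty      = λ i → i
decodeT (square t) = prepend 0 (decodeT t)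
decodeT (domino t) = prepend 1 (prepend 0 (decodeT t))

decodeH : ∀ {n} → Hook n → ℕ → ℕ
decodeH (close t)  = prepend 0 (decodeT t)
decodeH (extend h) = prepend 1 (decodeH h)

decode : ∀ {n} → Shape n → ℕ → ℕ
decode (layered t) = decodeT t
decode (hooked h)  = prepend 2 (prepend 0 (decodeH h))

hook : ∀ {n} k → Tiling n → Hook (k + n)
hook zero    t = close t
hook (suc k) t = extend (hook k t)

decodeH-hook-< : ∀ {n} k (t : Tiling n) {j} → j < k → decodeH (hook k t) j ≡ suc j
decodeH-hook-< (suc k) t {zero}  _         = refl
decodeH-hook-< (suc k) t {suc j} (s<s j<k) = cong (punchIn 1) (decodeH-hook-< k t j<k)

decodeH-hook-≡ : ∀ {n} k (t : Tiling n) → decodeH (hook k t) k ≡ 0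
decodeH-hook-≡ zero    t = refl
decodeH-hook-≡ (suc k) t = cong (punchIn 1) (decodeH-hook-≡ k t)

decodeH-hook-> : ∀ {n} k (t : Tiling n) i → decodeH (hook k t) (suc (k + i)) ≡ suc (k + decodeT t i)
decodeH-hook-> zero    t i = refl
decodeH-hook-> (suc k) t i = cong (punchIn 1) (decodeH-hook-> k t i)

admissible-decodeT : ∀ {n} (t : Tiling n) → Admissible (λ _ → ⊥) n (decodeT t)
admissible-decodeT empty      = admissible (λ _ ()) (λ _ _ ()) (λ _ _ ()) (λ _ _ _ _ _ ()) (λ _ _ _ _ _ ())
admissible-decodeT (square t) = admissible-prepend0 (admissible-decodeT t)
admissible-decodeT (domino t) = admissible-prepend1 (λ ()) (inj₂ refl) (admissible-prepend0 (admissible-decodeT t))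

admissible-decodeH : ∀ {n} (h : Hook n) → Admissible (_≡ 1) (suc n) (decodeH h)
admissible-decodeH (close t)  = admissible-prepend0 (admissible-weaken (λ ()) (admissible-decodeT t))
admissible-decodeH (extend h) = admissible-prepend1 (λ x≡1 → x≡1) (inj₁ refl) (admissible-decodeH h)

goodMap-decode : ∀ {n} (s : Shape n) → GoodMap n (decode s)
goodMap-decode (layered t) = admissible⇒goodMap (admissible-decodeT t)
goodMap-decode (hooked h)  =
  goodMap-prepend2 refl (admissible-prepend0 (admissible-weaken (cong suc) (admissible-decodeH h)))

module _ {A B C : Set} {f : A → C} {g : B → C} where

  unique-map-++ : (∀ {x y} → f x ≡ f y → x ≡ y) → (∀ {x y} → g x ≡ g y → x ≡ y) → (∀ {x y} → f x ≢ g y) →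
                  ∀ {xs ys} → Unique xs → Unique ys → Unique (map f xs ++ map g ys)
  unique-map-++ f-inj g-inj f≢g uxs uys = ++⁺ (map⁺ f-inj uxs) (map⁺ g-inj uys) disjoint
    where
    disjoint : ∀ {z} → ¬ (z ∈ map f _ × z ∈ map g _)
    disjoint (z∈fxs , z∈gys) with ∈-map⁻ f z∈fxs | ∈-map⁻ g z∈gys
    ... | _ , _ , refl | _ , _ , fx≡gy = f≢g fx≡gy

tilings : ∀ n → List (Tiling n)
tilings zero          = empty ∷ []
tilings (suc zero)    = map square (tilings 0)
tilings (suc (suc n)) = map square (tilings (suc n)) ++ map domino (tilings n)

hooks : ∀ n → List (Hook n)
hooks zero    = map close (tilings 0)
hooks (suc n) = map close (tilings (suc n)) ++ map extend (hooks n)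

shapes : ∀ n → List (Shape n)
shapes (suc (suc (suc n))) = map layered (tilings _) ++ map hooked (hooks n)
shapes n                   = map layered (tilings n)

∈-tilings : ∀ {n} (t : Tiling n) → t ∈ tilings n
∈-tilings empty              = here refl
∈-tilings (square {zero} t)  = ∈-map⁺ square (∈-tilings t)
∈-tilings (square {suc n} t) = ∈-++⁺ˡ (∈-map⁺ square (∈-tilings t))
∈-tilings (domino {n} t)     = ∈-++⁺ʳ (map square (tilings (suc n))) (∈-map⁺ domino (∈-tilings t))

∈-hooks : ∀ {n} (h : Hook n) → h ∈ hooks n
∈-hooks {zero}  (close t)  = ∈-map⁺ close (∈-tilings t)
∈-hooks {suc n} (close t)  = ∈-++⁺ˡ (∈-map⁺ close (∈-tilings t))
∈-hooks {suc n} (extend h) = ∈-++⁺ʳ (map close (tilings (suc n))) (∈-map⁺ extend (∈-hooks h))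

∈-shapes : ∀ {n} (s : Shape n) → s ∈ shapes n
∈-shapes {zero}             (layered t) = ∈-map⁺ layered (∈-tilings t)
∈-shapes {suc zero}         (layered t) = ∈-map⁺ layered (∈-tilings t)
∈-shapes {suc (suc zero)}   (layered t) = ∈-map⁺ layered (∈-tilings t)
∈-shapes {suc (suc (suc n))} (layered t) = ∈-++⁺ˡ (∈-map⁺ layered (∈-tilings t))
∈-shapes (hooked {n} h)                 = ∈-++⁺ʳ (map layered (tilings (suc (suc (suc n))))) (∈-map⁺ hooked (∈-hooks h))

unique-tilings : ∀ n → Unique (tilings n)
unique-tilings zero          = [] ∷ []
unique-tilings (suc zero)    = map⁺ {f = square} (λ { refl → refl }) (unique-tilings 0)
unique-tilings (suc (suc n)) =
  unique-map-++ (λ { refl → refl }) (λ { refl → refl }) (λ ()) (unique-tilings (suc n)) (unique-tilings n)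

unique-hooks : ∀ n → Unique (hooks n)
unique-hooks zero    = map⁺ {f = close} (λ { refl → refl }) (unique-tilings 0)
unique-hooks (suc n) =
  unique-map-++ (λ { refl → refl }) (λ { refl → refl }) (λ ()) (unique-tilings (suc n)) (unique-hooks n)

unique-shapes : ∀ n → Unique (shapes n)
unique-shapes zero                = map⁺ {f = layered} (λ { refl → refl }) (unique-tilings 0)
unique-shapes (suc zero)          = map⁺ {f = layered} (λ { refl → refl }) (unique-tilings 1)
unique-shapes (suc (suc zero))    = map⁺ {f = layered} (λ { refl → refl }) (unique-tilings 2)
unique-shapes (suc (suc (suc n))) =
  unique-map-++ (λ { refl → refl }) (λ { refl → refl }) (λ ()) (unique-tilings _) (unique-hooks n)

length-map-++ : ∀ {A B C : Set} (f : A → C) (g : B → C) xs ys →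
                length (map f xs ++ map g ys) ≡ length xs + length ys
length-map-++ f g xs ys =
  trans (length-++ (map f xs)) (cong₂ _+_ (length-map f xs) (length-map g ys))

length-tilings : ∀ n → length (tilings n) ≡ F n
length-tilings zero          = refl
length-tilings (suc zero)    = refl
length-tilings (suc (suc n)) =
  trans (length-map-++ square domino (tilings (suc n)) (tilings n))
        (cong₂ _+_ (length-tilings (suc n)) (length-tilings n))

1+length-hooks : ∀ n → suc (length (hooks n)) ≡ F (suc (suc n))
1+length-hooks zero    = refl
1+length-hooks (suc n) = begin
  suc (length (map close (tilings (suc n)) ++ map extend (hooks n)))
    ≡⟨ cong suc (length-map-++ close extend (tilings (suc n)) (hooks n)) ⟩
  suc (length (tilings (suc n)) + length (hooks n))
    ≡⟨ sym (+-suc _ _) ⟩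
  length (tilings (suc n)) + suc (length (hooks n))
    ≡⟨ cong₂ _+_ (length-tilings (suc n)) (1+length-hooks n) ⟩
  F (suc n) + F (suc (suc n))
    ≡⟨ +-comm (F (suc n)) _ ⟩
  F (suc (suc (suc n))) ∎
  where open ≡-Reasoning

length-shapes : ∀ n → length (shapes (suc n)) ≡ F (suc (suc n)) ∸ 1
length-shapes zero          = refl
length-shapes (suc zero)    = refl
length-shapes (suc (suc n)) = begin
  length (map layered (tilings (3 + n)) ++ map hooked (hooks n))
    ≡⟨ length-map-++ layered hooked (tilings (3 + n)) (hooks n) ⟩
  length (tilings (3 + n)) + length (hooks n)
    ≡⟨ sym (cong (_∸ 1) (+-suc (length (tilings (3 + n))) _)) ⟩
  (length (tilings (3 + n)) + suc (length (hooks n))) ∸ 1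
    ≡⟨ cong (_∸ 1) (cong₂ _+_ (length-tilings (3 + n)) (1+length-hooks n)) ⟩
  F (suc (suc (suc (suc n)))) ∸ 1 ∎
  where open ≡-Reasoning

Agree : ℕ → (ℕ → ℕ) → (ℕ → ℕ) → Set
Agree n f g = ∀ i → i < n → f i ≡ g i

agree-prepend : ∀ {n v v′ h h′} → Agree (suc n) (prepend v h) (prepend v′ h′) → v ≡ v′ × Agree n h h′
agree-prepend {v = v} {h = h} {h′ = h′} ag = v≡v′ , λ i i<n →
  punchIn-injective v (trans (ag (suc i) (s<s i<n)) (cong (λ w → punchIn w (h′ i)) (sym v≡v′)))
  where v≡v′ = ag 0 z<s

agree-cast : ∀ {m n r f} (e : m ≡ n) (s : Shape m) → Agree r f (decode s) → Agree r f (decode (subst Shape e s))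
agree-cast refl _ ag = ag

decodeT-injective : ∀ {n} (t t′ : Tiling n) → Agree n (decodeT t) (decodeT t′) → t ≡ t′
decodeT-injective empty      empty       _  = refl
decodeT-injective (square t) (square t′) ag = cong square (decodeT-injective t t′ (proj₂ (agree-prepend ag)))
decodeT-injective (square t) (domino t′) ag = ⊥-elim (0≢1+n (ag 0 z<s))
decodeT-injective (domino t) (square t′) ag = ⊥-elim (1+n≢0 (ag 0 z<s))
decodeT-injective (domino t) (domino t′) ag =
  cong domino (decodeT-injective t t′ (proj₂ (agree-prepend (proj₂ (agree-prepend ag)))))

decodeH-injective : ∀ {n} (h h′ : Hook n) → Agree (suc n) (decodeH h) (decodeH h′) → h ≡ h′
decodeH-injective (close t)  (close t′)  ag = cong close (decodeT-injective t t′ (proj₂ (agree-prepend ag)))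
decodeH-injective (close t)  (extend h′) ag = ⊥-elim (0≢1+n (ag 0 z<s))
decodeH-injective (extend h) (close t′)  ag = ⊥-elim (1+n≢0 (ag 0 z<s))
decodeH-injective (extend h) (extend h′) ag = cong extend (decodeH-injective h h′ (proj₂ (agree-prepend ag)))

decode-injective : ∀ {n} (s s′ : Shape n) → Agree n (decode s) (decode s′) → s ≡ s′
decode-injective (layered t)          (layered t′)          ag = cong layered (decodeT-injective t t′ ag)
decode-injective (layered (square t)) (hooked h′)           ag = ⊥-elim (0≢1+n (ag 0 z<s))
decode-injective (layered (domino t)) (hooked h′)           ag = ⊥-elim (0≢1+n (suc-injective (ag 0 z<s)))
decode-injective (hooked h)           (layered (square t′)) ag = ⊥-elim (1+n≢0 (ag 0 z<s))
decode-injective (hooked h)           (layered (domino t′)) ag = ⊥-elim (1+n≢0 (suc-injective (ag 0 z<s)))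
decode-injective (hooked h)           (hooked h′)           ag =
  cong hooked (decodeH-injective h h′ (proj₂ (agree-prepend (proj₂ (agree-prepend ag)))))

-- Every good permutation is the decoding of a shape

offset-cases : ∀ {m x} → m ≤ x → x ≡ m ⊎ x ≡ suc m ⊎ x ≡ 2 + m ⊎ 3 + m ≤ x
offset-cases m≤x with m≤n⇒m<n∨m≡n m≤x
... | inj₂ refl = inj₁ refl
... | inj₁ m<x with m≤n⇒m<n∨m≡n m<x
...   | inj₂ refl = inj₂ (inj₁ refl)
...   | inj₁ 1+m<x with m≤n⇒m<n∨m≡n 1+m<x
...     | inj₂ refl = inj₂ (inj₂ (inj₁ refl))
...     | inj₁ 2+m<x = inj₂ (inj₂ (inj₂ 2+m<x))

module Characterisation {n f} (good : GoodMap n f) (surj : SurjectiveOn n f) where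
  open GoodMap good

  SplitsAt : ℕ → Set
  SplitsAt m = (∀ i → i < m → f i < m) × (∀ w → w < m → ∃ λ i → i < m × f i ≡ w)

  splitsAt-0 : SplitsAt 0
  splitsAt-0 = (λ _ ()) , (λ _ ())

  same-value : ∀ {i j w} → i < n → j < n → f i ≡ w → f j ≡ w → i ≡ j
  same-value i<n j<n fi≡w fj≡w = injective _ _ i<n j<n (trans fi≡w (sym fj≡w))

  splitsAt-≥ : ∀ {m i} → SplitsAt m → m ≤ i → i < n → m ≤ f i
  splitsAt-≥ {m} {i} (_ , onto) m≤i i<n with m ≤? f i
  ... | yes m≤fi = m≤fi
  ... | no m≰fi with onto (f i) (≰⇒> m≰fi)
  ...   | j , j<m , fj≡fi with same-value (<-trans (<-≤-trans j<m m≤i) i<n) i<n fj≡fi refl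
  ...     | refl = ⊥-elim (<⇒≱ j<m m≤i)

  position-below : ∀ {m w} → SplitsAt m → m < n → m ≤ w → w < f m → ∃ λ p → m < p × p < n × f p ≡ w
  position-below {m} (into , _) m<n m≤w w<fm with surj _ (<-trans w<fm (bounded m m<n))
  ... | p , p<n , fp≡w with <-cmp m p
  ...   | tri< m<p _ _ = p , m<p , p<n , fp≡w
  ...   | tri≈ _ refl _ = ⊥-elim (<-irrefl (sym fp≡w) w<fm)
  ...   | tri> _ _ p<m = ⊥-elim (<⇒≱ (subst (_< m) fp≡w (into p p<m)) m≤w)

  ordered-below : ∀ {m p q} → m < p → m < q → p < n → q < n → f p < f q → f q < f m → p < q
  ordered-below {m} {p} {q} m<p m<q p<n q<n fp<fq fq<fm with <-cmp p q
  ... | tri< p<q _ _ = p<q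
  ... | tri≈ _ refl _ = ⊥-elim (<-irrefl refl fp<fq)
  ... | tri> _ _ q<p = ⊥-elim (avoids321 m q p m<q q<p p<n fp<fq fq<fm)

  values-< : ∀ {p q a b} → f p ≡ a → f q ≡ b → a < b → f p < f q
  values-< fp≡a fq≡b = subst₂ _<_ (sym fp≡a) (sym fq≡b)

  -- The values m, m+1, m+2 lie right of position m in increasing order (else a 321 with f m), so
  -- with f m they form a 4123.
  no-big-jump : ∀ {m} → SplitsAt m → m < n → 3 + m ≤ f m → ⊥
  no-big-jump {m} split m<n 3+m≤fm
    with below ≤-refl (≤-trans (m≤n+m (suc m) 2) 3+m≤fm)
       | below (m≤n+m m 1) (≤-trans (m≤n+m (2 + m) 1) 3+m≤fm)
       | below (m≤n+m m 2) 3+m≤fm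
    where
    below : ∀ {w} → m ≤ w → w < f m → ∃ λ p → m < p × p < n × f p ≡ w
    below = position-below split m<n
  ... | p₀ , m<p₀ , p₀<n , fp₀ | p₁ , m<p₁ , p₁<n , fp₁ | p₂ , m<p₂ , p₂<n , fp₂ =
    avoids4123 m p₀ p₁ p₂ m<p₀ p₀<p₁ p₁<p₂ p₂<n f₀<f₁ f₁<f₂ f₂<fm
    where
    f₀<f₁ = values-< fp₀ fp₁ (n<1+n m)
    f₁<f₂ = values-< fp₁ fp₂ (n<1+n (suc m))
    f₂<fm = subst (_< f m) (sym fp₂) 3+m≤fm
    p₀<p₁ = ordered-below m<p₀ m<p₁ p₀<n p₁<n f₀<f₁ (<-trans f₁<f₂ f₂<fm)
    p₁<p₂ = ordered-below m<p₁ m<p₂ p₁<n p₂<n f₁<f₂ f₂<fm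

  domino-partner : ∀ {m} → SplitsAt m → m < n → f m ≡ suc m → suc m < n × f (suc m) ≡ m
  domino-partner {m} split m<n fm≡1+m
    with position-below split m<n ≤-refl (subst (m <_) (sym fm≡1+m) (n<1+n m))
  ... | q , m<q , q<n , fq≡m = 1+m<n , partner
    where
    1+m<n = ≤-<-trans m<q q<n
    partner : f (suc m) ≡ m
    partner with offset-cases (splitsAt-≥ split (n≤1+n m) 1+m<n)
    ... | inj₁ e = e
    ... | inj₂ (inj₁ f1+m≡1+m) = ⊥-elim (1+n≢n (sym (same-value m<n 1+m<n fm≡1+m f1+m≡1+m)))
    ... | inj₂ (inj₂ rising) = ⊥-elim (fishburn m q 1+m<n q<n m<q fm<f1+m (trans fm≡1+m (cong suc (sym fq≡m))))
      where
      2+m≤f1+m : 2 + m ≤ f (suc m)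
      2+m≤f1+m = [ (λ e → ≤-reflexive (sym e)) , ≤-trans (m≤n+m _ 1) ]′ rising
      fm<f1+m = subst (_< f (suc m)) (sym fm≡1+m) 2+m≤f1+m

  jump-two : ∀ {m} → SplitsAt m → m < n → f m ≡ 2 + m →
             f (suc m) ≡ m × ∃ λ q → suc m < q × q < n × f q ≡ suc m
  jump-two {m} split m<n fm≡2+m
    with position-below split m<n ≤-refl (subst (m <_) (sym fm≡2+m) (m≤n+m _ 1))
       | position-below split m<n (n≤1+n m) (subst (suc m <_) (sym fm≡2+m) (n<1+n _))
  ... | q₀ , m<q₀ , q₀<n , fq₀ | q₁ , m<q₁ , q₁<n , fq₁ = partner , q₁ , 1+m<q₁ , q₁<n , fq₁
    where
    q₀<q₁ = ordered-below m<q₀ m<q₁ q₀<n q₁<n (values-< fq₀ fq₁ (n<1+n m)) (values-< fq₁ fm≡2+m (n<1+n _))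
    1+m<n = ≤-<-trans m<q₀ q₀<n
    partner : f (suc m) ≡ m
    partner with offset-cases (splitsAt-≥ split (n≤1+n m) 1+m<n)
    ... | inj₁ e = e
    ... | inj₂ (inj₁ e) with same-value q₁<n 1+m<n fq₁ e
    ...   | refl = ⊥-elim (<⇒≱ q₀<q₁ m<q₀)
    partner | inj₂ (inj₂ (inj₁ e)) = ⊥-elim (1+n≢n (sym (same-value m<n 1+m<n fm≡2+m e)))
    partner | inj₂ (inj₂ (inj₂ 3+m≤f1+m)) =
      ⊥-elim (fishburn m q₁ 1+m<n q₁<n m<q₁ (subst (_< f (suc m)) (sym fm≡2+m) 3+m≤f1+m)
                       (trans fm≡2+m (cong suc (sym fq₁))))
    1+m<q₁ : suc m < q₁
    1+m<q₁ = ≤∧≢⇒< m<q₁ λ { refl → 1+n≢n (trans (sym fq₁) partner) }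

  no-late-jump-two : ∀ {m} → SplitsAt (suc m) → suc m < n → f (suc m) ≡ 3 + m → ⊥
  no-late-jump-two {m} split 1+m<n f1+m≡3+m with jump-two split 1+m<n f1+m≡3+m
  ... | f2+m≡1+m , q , 2+m<q , q<n , fq≡2+m =
    avoids1423 0 (suc m) (2 + m) q z<s (n<1+n _) 2+m<q q<n
      (subst (f 0 <_) (sym f2+m≡1+m) (proj₁ split 0 z<s))
      (values-< f2+m≡1+m fq≡2+m (n<1+n _))
      (values-< fq≡2+m f1+m≡3+m (n<1+n _))

  splitsAt-square : ∀ {m} → SplitsAt m → f m ≡ m → SplitsAt (suc m)
  splitsAt-square {m} (into , onto) fm≡m = into′ , onto′
    where
    into′ : ∀ i → i < suc m → f i < suc m
    into′ i i<1+m with m<1+n⇒m<n∨m≡n i<1+m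
    ... | inj₁ i<m  = m<n⇒m<1+n (into i i<m)
    ... | inj₂ refl = subst (_< suc m) (sym fm≡m) (n<1+n m)
    onto′ : ∀ w → w < suc m → ∃ λ i → i < suc m × f i ≡ w
    onto′ w w<1+m with m<1+n⇒m<n∨m≡n w<1+m
    ... | inj₂ refl = m , n<1+n m , fm≡m
    ... | inj₁ w<m with onto w w<m
    ...   | i , i<m , fi≡w = i , m<n⇒m<1+n i<m , fi≡w

  splitsAt-domino : ∀ {m} → SplitsAt m → f m ≡ suc m → f (suc m) ≡ m → SplitsAt (2 + m)
  splitsAt-domino {m} (into , onto) fm≡1+m f1+m≡m = into′ , onto′
    where
    into′ : ∀ i → i < 2 + m → f i < 2 + m
    into′ i i<2+m with m<1+n⇒m<n∨m≡n i<2+m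
    ... | inj₂ refl = subst (_< 2 + m) (sym f1+m≡m) (m≤n+m _ 1)
    ... | inj₁ i<1+m with m<1+n⇒m<n∨m≡n i<1+m
    ...   | inj₁ i<m  = m<n⇒m<1+n (m<n⇒m<1+n (into i i<m))
    ...   | inj₂ refl = subst (_< 2 + m) (sym fm≡1+m) (n<1+n _)
    onto′ : ∀ w → w < 2 + m → ∃ λ i → i < 2 + m × f i ≡ w
    onto′ w w<2+m with m<1+n⇒m<n∨m≡n w<2+m
    ... | inj₂ refl = m , m≤n+m _ 1 , fm≡1+m
    ... | inj₁ w<1+m with m<1+n⇒m<n∨m≡n w<1+m
    ...   | inj₂ refl = suc m , n<1+n _ , f1+m≡m
    ...   | inj₁ w<m with onto w w<m
    ...     | i , i<m , fi≡w = i , m<n⇒m<1+n (m<n⇒m<1+n i<m) , fi≡w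

  AgreeFrom : ℕ → ℕ → (ℕ → ℕ) → Set
  AgreeFrom m r g = ∀ i → i < r → f (m + i) ≡ m + g i

  agreeFrom-square : ∀ {m r g} → f m ≡ m → AgreeFrom (suc m) r g → AgreeFrom m (suc r) (prepend 0 g)
  agreeFrom-square {m} fm≡m ag zero    _         = begin
    f (m + 0) ≡⟨ cong f (+-identityʳ m) ⟩
    f m       ≡⟨ fm≡m ⟩
    m         ≡⟨ +-identityʳ m ⟨
    m + 0     ∎
    where open ≡-Reasoning
  agreeFrom-square {m} {g = g} fm≡m ag (suc i) (s<s i<r) = begin
    f (m + suc i)   ≡⟨ cong f (+-suc m i) ⟩
    f (suc m + i)   ≡⟨ ag i i<r ⟩
    suc m + g i     ≡⟨ +-suc m (g i) ⟨
    m + suc (g i)   ∎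
    where open ≡-Reasoning

  agreeFrom-domino : ∀ {m r g} → f m ≡ suc m → f (suc m) ≡ m → AgreeFrom (2 + m) r g →
                     AgreeFrom m (2 + r) (prepend 1 (prepend 0 g))
  agreeFrom-domino {m} fm≡1+m f1+m≡m ag zero _ = begin
    f (m + 0) ≡⟨ cong f (+-identityʳ m) ⟩
    f m       ≡⟨ fm≡1+m ⟩
    suc m     ≡⟨ +-comm m 1 ⟨
    m + 1     ∎
    where open ≡-Reasoning
  agreeFrom-domino {m} fm≡1+m f1+m≡m ag (suc zero) _ = begin
    f (m + 1) ≡⟨ cong f (+-comm m 1) ⟩
    f (suc m) ≡⟨ f1+m≡m ⟩
    m         ≡⟨ +-identityʳ m ⟨
    m + 0     ∎
    where open ≡-Reasoning
  agreeFrom-domino {m} {g = g} fm≡1+m f1+m≡m ag (suc (suc i)) (s<s (s<s i<r)) = begin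
    f (m + (2 + i))  ≡⟨ cong f (+-suc-suc m i) ⟩
    f (2 + m + i)    ≡⟨ ag i i<r ⟩
    2 + m + g i      ≡⟨ +-suc-suc m (g i) ⟨
    m + (2 + g i)    ∎
    where
    open ≡-Reasoning
    +-suc-suc : ∀ a b → a + (2 + b) ≡ 2 + a + b
    +-suc-suc a b = trans (+-suc a (suc b)) (cong suc (+-suc a b))

  classify : ∀ {m} → SplitsAt m → m < n → f m ≡ m ⊎ f m ≡ suc m ⊎ f m ≡ 2 + m
  classify split m<n with offset-cases (splitsAt-≥ split ≤-refl m<n)
  ... | inj₁ e               = inj₁ e
  ... | inj₂ (inj₁ e)        = inj₂ (inj₁ e)
  ... | inj₂ (inj₂ (inj₁ e)) = inj₂ (inj₂ e)
  ... | inj₂ (inj₂ (inj₂ big)) = ⊥-elim (no-big-jump split m<n big)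

  tiling-from : ∀ r m → 0 < m ⊎ f 0 ≢ 2 → r + m ≡ n → SplitsAt m →
                Σ (Tiling r) λ t → AgreeFrom m r (decodeT t)
  tiling-from zero    m _ _ _ = empty , λ _ ()
  tiling-from (suc r) m start 1+r+m≡n split with classify split (subst (m <_) 1+r+m≡n (m<n+m m z<s))
  ... | inj₁ fm≡m with tiling-from r (suc m) (inj₁ z<s) (trans (+-suc r m) 1+r+m≡n) (splitsAt-square split fm≡m)
  ...   | t , ag = square t , agreeFrom-square fm≡m ag
  tiling-from (suc r) m start 1+r+m≡n split | inj₂ (inj₁ fm≡1+m)
    with r | 1+r+m≡n | domino-partner split (subst (m <_) 1+r+m≡n (m<n+m m z<s)) fm≡1+m
  ... | zero   | 1+m≡n   | 1+m<n , _ = ⊥-elim (<-irrefl 1+m≡n 1+m<n)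
  ... | suc r′ | 2+r′+m≡n | _ , f1+m≡m
    with tiling-from r′ (2 + m) (inj₁ z<s) (trans (+-suc r′ (suc m)) (trans (cong suc (+-suc r′ m)) 2+r′+m≡n))
                     (splitsAt-domino split fm≡1+m f1+m≡m)
  ...   | t , ag = domino t , agreeFrom-domino fm≡1+m f1+m≡m ag
  tiling-from (suc r) zero    (inj₂ f0≢2) _ split | inj₂ (inj₂ f0≡2) = ⊥-elim (f0≢2 f0≡2)
  tiling-from (suc r) (suc m) _ 1+r+m≡n split | inj₂ (inj₂ f1+m≡3+m) =
    ⊥-elim (no-late-jump-two split (subst (suc m <_) 1+r+m≡n (m<n+m _ z<s)) f1+m≡3+m)

  module HookCase {k} (f0≡2 : f 0 ≡ 2) (f1≡0 : f 1 ≡ 0) (f[2+k]≡1 : f (2 + k) ≡ 1) (2+k<n : 2 + k < n) where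

    Prefix : ℕ → Set
    Prefix t = ∀ j → j < t → f (2 + j) ≡ 3 + j

    prefix-into : ∀ {t} → Prefix t → ∀ p → p < 2 + t → f p < 3 + t
    prefix-into pre zero            _                 = subst (_< _) (sym f0≡2) (s<s (s<s (s<s z≤n)))
    prefix-into pre (suc zero)      _                 = subst (_< _) (sym f1≡0) z<s
    prefix-into pre (suc (suc j)) (s<s (s<s j<t)) = subst (_< _) (sym (pre j j<t)) (s<s (s<s (s<s j<t)))

    prefix-cover : ∀ {t} → Prefix t → ∀ w → w < 3 + t → ∃ λ p → (p < 2 + t ⊎ p ≡ 2 + k) × f p ≡ w
    prefix-cover pre zero                _ = 1 , inj₁ (s<s z<s) , f1≡0
    prefix-cover pre (suc zero)          _ = 2 + k , inj₂ refl , f[2+k]≡1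
    prefix-cover pre (suc (suc zero))    _ = 0 , inj₁ z<s , f0≡2
    prefix-cover pre (suc (suc (suc j))) (s<s (s<s (s<s j<t))) = 2 + j , inj₁ (s<s (s<s j<t)) , pre j j<t

    inner<n : ∀ {t} → t < k → 2 + t < n
    inner<n t<k = <-trans (s<s (s<s t<k)) 2+k<n

    prefix-lower : ∀ {t} → Prefix t → t < k → 3 + t ≤ f (2 + t)
    prefix-lower {t} pre t<k = ≮⇒≥ (λ small → taken (prefix-cover pre _ small))
      where
      taken : (∃ λ p → (p < 2 + t ⊎ p ≡ 2 + k) × f p ≡ f (2 + t)) → ⊥
      taken (p , inj₁ p<2+t , fp≡) = <-irrefl (same-value (<-trans p<2+t (inner<n t<k)) (inner<n t<k) fp≡ refl) p<2+t
      taken (p , inj₂ refl  , fp≡) =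
        <-irrefl (sym (suc-injective (suc-injective (same-value 2+k<n (inner<n t<k) fp≡ refl)))) t<k

    prefix-upper : ∀ {t} → Prefix t → t < k → f (2 + t) ≤ 3 + t
    prefix-upper {t} pre t<k = ≮⇒≥ (λ big → no-position big (surj (3 + t) (<-trans big (bounded _ (inner<n t<k)))))
      where
      no-position : 3 + t < f (2 + t) → (∃ λ r → r < n × f r ≡ 3 + t) → ⊥
      no-position big (r , r<n , fr≡) with <-cmp r (2 + t) | <-cmp r (2 + k)
      ... | tri< r<2+t _ _ | _              = <-irrefl fr≡ (prefix-into pre r r<2+t)
      ... | tri≈ _ refl _  | _              = <-irrefl (sym fr≡) big
      ... | tri> _ _ 2+t<r | tri≈ _ refl _  = 0≢1+n (suc-injective (trans (sym f[2+k]≡1) fr≡))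
      ... | tri> _ _ 2+t<r | tri< r<2+k _ _ =
        avoids321 (2 + t) r (2 + k) 2+t<r r<2+k 2+k<n (values-< f[2+k]≡1 fr≡ (s<s z<s)) (subst (_< f (2 + t)) (sym fr≡) big)
      ... | tri> _ _ 2+t<r | tri> _ _ 2+k<r =
        avoids1423 1 (2 + t) (2 + k) r (s<s z<s) (s<s (s<s t<k)) 2+k<r r<n
          (values-< f1≡0 f[2+k]≡1 z<s) (values-< f[2+k]≡1 fr≡ (s<s z<s)) (subst (_< f (2 + t)) (sym fr≡) big)

    prefix : ∀ t → t ≤ k → Prefix t
    prefix zero    _     _ ()
    prefix (suc t) 1+t≤k j j<1+t with m<1+n⇒m<n∨m≡n j<1+t
    ... | inj₁ j<t  = prefix t (<⇒≤ 1+t≤k) j j<t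
    ... | inj₂ refl = ≤-antisym (prefix-upper pre 1+t≤k) (prefix-lower pre 1+t≤k)
      where pre = prefix t (<⇒≤ 1+t≤k)

    splitsAt-hook : SplitsAt (3 + k)
    splitsAt-hook = into , onto
      where
      into : ∀ i → i < 3 + k → f i < 3 + k
      into i i<3+k with m<1+n⇒m<n∨m≡n i<3+k
      ... | inj₁ i<2+k = prefix-into (prefix k ≤-refl) i i<2+k
      ... | inj₂ refl  = subst (_< 3 + k) (sym f[2+k]≡1) (s<s (s<s z≤n))
      onto : ∀ w → w < 3 + k → ∃ λ i → i < 3 + k × f i ≡ w
      onto w w<3+k with prefix-cover (prefix k ≤-refl) w w<3+k
      ... | p , inj₁ p<2+k , fp≡w = p , m<n⇒m<1+n p<2+k , fp≡w
      ... | p , inj₂ refl  , fp≡w = p , n<1+n _ , fp≡w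

    hook-agrees : ∀ {r} (t : Tiling r) → 3 + (k + r) ≡ n → AgreeFrom (3 + k) r (decodeT t) →
                  Agree n f (decode (hooked (hook k t)))
    hook-agrees t _ _ zero          _ = f0≡2
    hook-agrees t _ _ (suc zero)    _ = f1≡0
    hook-agrees t _ _ (suc (suc j)) _ with <-cmp j k
    ... | tri< j<k _ _ = trans (prefix k ≤-refl j j<k) (cong (λ x → punchIn 2 (suc x)) (sym (decodeH-hook-< k t j<k)))
    ... | tri≈ _ refl _ = trans f[2+k]≡1 (cong (λ x → punchIn 2 (suc x)) (sym (decodeH-hook-≡ k t)))
    hook-agrees t size ag (suc (suc j)) 2+j<n | tri> _ _ k<j with m≤n⇒∃[o]m+o≡n k<j
    ... | o , refl = trans (ag o o<r) (cong (λ x → punchIn 2 (suc x)) (sym (decodeH-hook-> k t o)))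
      where o<r = +-cancelˡ-< (3 + k) _ _ (subst (3 + (k + o) <_) (sym size) 2+j<n)

    hook-shape : Σ (Shape n) λ s → Agree n f (decode s)
    hook-shape with m≤n⇒∃[o]m+o≡n 2+k<n
    ... | r , size with tiling-from r (3 + k) (inj₁ z<s) (trans (+-comm r (3 + k)) size) splitsAt-hook
    ...   | t , ag = subst Shape size (hooked (hook k t)) , agree-cast size _ (hook-agrees t size ag)

  hook-start : f 0 ≡ 2 → 0 < n → ∃ λ k → f 1 ≡ 0 × f (2 + k) ≡ 1 × 2 + k < n
  hook-start f0≡2 0<n with jump-two splitsAt-0 0<n f0≡2
  ... | _    , suc zero    , s<s () , _
  ... | f1≡0 , suc (suc k) , _      , 2+k<n , f[2+k]≡1 = k , f1≡0 , f[2+k]≡1 , 2+k<n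

  shape : 0 < n → Σ (Shape n) λ s → Agree n f (decode s)
  shape 0<n with f 0 ≟ 2
  ... | no f0≢2 with tiling-from n 0 (inj₂ f0≢2) (+-identityʳ n) splitsAt-0
  ...   | t , ag = layered t , ag
  shape 0<n | yes f0≡2 with hook-start f0≡2 0<n
  ... | k , f1≡0 , f[2+k]≡1 , 2+k<n = HookCase.hook-shape f0≡2 f1≡0 f[2+k]≡1 2+k<n

-- Permutations as words and as functions ℕ → ℕ

-- If w were not hit, punching it out of the codomain would inject Fin (suc m) into Fin m.
injective⇒surjective : ∀ {m} (h : Fin m → Fin m) → (∀ i j → h i ≡ h j → i ≡ j) → ∀ w → ∃ λ i → h i ≡ w
injective⇒surjective {suc m} h inj w with any? (λ i → h i ≟ᶠ w)
... | yes hit = hit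
... | no miss with pigeonhole (n<1+n m) (λ i → punchOut {i = w} {j = h i} (λ w≡hi → miss (i , sym w≡hi)))
...   | i , j , i<j , same =
  ⊥-elim (<-irrefl (cong toℕ (inj i j (punchOut-injective (λ w≡hi → miss (i , sym w≡hi)) (λ w≡hj → miss (j , sym w≡hj)) same))) i<j)

increasing-by-steps : ∀ {k} (v : Fin (suc k) → ℕ) → (∀ i → v (inject₁ i) < v (suc i)) →
                      ∀ a b → a Fin.< b → v a < v b
increasing-by-steps {suc k} v step zero    (suc zero)    _         = step zero
increasing-by-steps {suc k} v step zero    (suc (suc b)) _         =
  <-trans (step zero) (increasing-by-steps (v ∘ suc) (step ∘ suc) zero (suc b) z<s)
increasing-by-steps {suc k} v step (suc a) (suc b)       (s<s a<b) =
  increasing-by-steps (v ∘ suc) (step ∘ suc) a b a<b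

≤-by-steps : ∀ {k} (v : Fin (suc k) → ℕ) → (∀ i → v (inject₁ i) < v (suc i)) → ∀ a → v a ≤ v (Fin.fromℕ k)
≤-by-steps {k} v step a with m≤n⇒m<n∨m≡n (≤fromℕ a)
... | inj₁ a<last = <⇒≤ (increasing-by-steps v step a (Fin.fromℕ k) a<last)
... | inj₂ a≡last = ≤-reflexive (cong v (toℕ-injective a≡last))

record Represents {n} (π : Word n) (g : ℕ → ℕ) : Set where
  constructor represents
  field toℕ-lookup : ∀ i → toℕ (lookup π i) ≡ g (toℕ i)

module _ {N : ℕ} {π : Word (suc N)} {g : ℕ → ℕ} (rep : Represents π g) where

  open Represents rep

  private
    n = suc N

  represents-via : ∀ (X : Fin n) {x} → toℕ X ≡ x → toℕ (lookup π X) ≡ g x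
  represents-via X X≡x = trans (toℕ-lookup X) (cong g X≡x)

  represents-at : ∀ {x} (x<n : x < n) → toℕ (lookup π (fromℕ< x<n)) ≡ g x
  represents-at x<n = represents-via (fromℕ< x<n) (toℕ-fromℕ< x<n)

  represents-< : ∀ {i j : Fin n} → lookup π i Fin.< lookup π j → g (toℕ i) < g (toℕ j)
  represents-< {i} {j} = subst₂ _<_ (toℕ-lookup i) (toℕ-lookup j)

  represents-bounded : Bounded n g
  represents-bounded x x<n = subst (_< n) (represents-at x<n) (toℕ<n _)

  isPerm⇒injectiveOn : IsPerm π → InjectiveOn n g
  isPerm⇒injectiveOn perm i j i<n j<n gi≡gj = begin
    i                      ≡⟨ toℕ-fromℕ< i<n ⟨
    toℕ (fromℕ< i<n)       ≡⟨ cong toℕ (perm _ _ (toℕ-injective same)) ⟩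
    toℕ (fromℕ< j<n)       ≡⟨ toℕ-fromℕ< j<n ⟩
    j                      ∎
    where
    open ≡-Reasoning
    same = trans (represents-at i<n) (trans gi≡gj (sym (represents-at j<n)))

  injectiveOn⇒isPerm : InjectiveOn n g → IsPerm π
  injectiveOn⇒isPerm inj i j πi≡πj =
    toℕ-injective (inj (toℕ i) (toℕ j) (toℕ<n i) (toℕ<n j) (trans (sym (toℕ-lookup i)) (trans (cong toℕ πi≡πj) (toℕ-lookup j))))

  isPerm⇒surjectiveOn : IsPerm π → SurjectiveOn n g
  isPerm⇒surjectiveOn perm w w<n with injective⇒surjective (lookup π) perm (fromℕ< w<n)
  ... | i , πi≡w = toℕ i , toℕ<n i , trans (sym (toℕ-lookup i)) (trans (cong toℕ πi≡w) (toℕ-fromℕ< w<n))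

  isFishburn⇒fishburn : IsFishburn π → Fishburn n g
  isFishburn⇒fishburn fish i j 1+i<n j<n i<j gi<g1+i gi≡1+gj =
    fish I J ( subst₂ _<_ (sym I≡i) (sym J≡j) i<j
             , subst₂ _<_ (sym vJ) (sym vI) (subst (g j <_) (sym gi≡1+gj) (n<1+n (g j)))
             , subst₂ _<_ (sym vI) (sym v1+I) gi<g1+i
             , trans vI (trans gi≡1+gj (cong suc (sym vJ))) )
    where
    I = fromℕ< (≤-pred 1+i<n)
    J = fromℕ< j<n
    I≡i = trans (toℕ-inject₁ I) (toℕ-fromℕ< _)
    J≡j = toℕ-fromℕ< j<n
    vI = represents-via (inject₁ I) I≡i
    vJ = represents-via J J≡j
    v1+I = represents-via (suc I) (cong suc (toℕ-fromℕ< _))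

  fishburn⇒isFishburn : Fishburn n g → IsFishburn π
  fishburn⇒isFishburn fish I J (I<J , _ , rise , adjacent) =
    fish (toℕ I) (toℕ J) (s<s (toℕ<n I)) (toℕ<n J) (subst (_< toℕ J) (toℕ-inject₁ I) I<J)
      (subst₂ _<_ vI (toℕ-lookup (suc I)) rise) (trans (sym vI) (trans adjacent (cong suc (toℕ-lookup J))))
    where vI = represents-via (inject₁ I) (toℕ-inject₁ I)

  -- Positions need only increase step by step, and so do the values read in the order listed by p⁻¹.
  contains-by-steps : ∀ {k} (p p⁻¹ : Vec (Fin (suc k)) (suc k)) → (∀ a → lookup p⁻¹ (lookup p a) ≡ a) →
                      (x : Vec ℕ (suc k)) → lookup x (Fin.fromℕ k) < n →
                      (∀ i → lookup x (inject₁ i) < lookup x (suc i)) →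
                      (∀ i → g (lookup x (lookup p⁻¹ (inject₁ i))) < g (lookup x (lookup p⁻¹ (suc i)))) →
                      Contains π p
  contains-by-steps {k} p p⁻¹ inverse x last<n position-steps value-steps =
    e , (λ a b a<b → subst₂ _<_ (sym (e≡x a)) (sym (e≡x b)) (increasing-by-steps (lookup x) position-steps a b a<b))
      , λ a b → mk⇔ (forward a b) (backward a b)
    where
    x<n : ∀ a → lookup x a < n
    x<n a = ≤-<-trans (≤-by-steps (lookup x) position-steps a) last<n
    e : Vec (Fin n) (suc k)
    e = tabulate (λ a → fromℕ< (x<n a))
    e≡x : ∀ a → toℕ (lookup e a) ≡ lookup x a
    e≡x a = trans (cong toℕ (lookup∘tabulate (λ b → fromℕ< (x<n b)) a)) (toℕ-fromℕ< (x<n a))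
    forward : ∀ a b → lookup p a Fin.< lookup p b → lookup π (lookup e a) Fin.< lookup π (lookup e b)
    forward a b pa<pb =
      subst₂ _<_ (sym (represents-via _ (e≡x a))) (sym (represents-via _ (e≡x b)))
        (subst₂ (λ a′ b′ → g (lookup x a′) < g (lookup x b′)) (inverse a) (inverse b)
          (increasing-by-steps (λ j → g (lookup x (lookup p⁻¹ j))) value-steps _ _ pa<pb))
    backward : ∀ a b → lookup π (lookup e a) Fin.< lookup π (lookup e b) → lookup p a Fin.< lookup p b
    backward a b πa<πb with <-cmpᶠ (lookup p a) (lookup p b)
    ... | tri< pa<pb _ _ = pa<pb
    ... | tri> _ _ pb<pa = ⊥-elim (<-asym πa<πb (forward b a pb<pa))
    ... | tri≈ _ pa≡pb _ with trans (sym (inverse a)) (trans (cong (lookup p⁻¹) pa≡pb) (inverse b))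
    ...   | refl = ⊥-elim (<-irrefl refl πa<πb)

  contains-< : ∀ {k} (p : Vec (Fin k) k) ((e , _) : Contains π p) →
               ∀ a b → lookup p a Fin.< lookup p b → g (toℕ (lookup e a)) < g (toℕ (lookup e b))
  contains-< p (_ , _ , iso) a b pa<pb = represents-< (Equivalence.to (iso a b) pa<pb)

  avoids-p321⇒avoids321 : Avoids π p321 → Avoids321 n g
  avoids-p321⇒avoids321 av a b c a<b b<c c<n gc<gb gb<ga =
    av (contains-by-steps p321 p321 (λ { zero → refl ; (suc zero) → refl ; (suc (suc zero)) → refl })
          (a ∷ b ∷ c ∷ []) c<n (λ { zero → a<b ; (suc zero) → b<c }) (λ { zero → gc<gb ; (suc zero) → gb<ga }))

  avoids-p1423⇒avoids1423 : Avoids π p1423 → Avoids1423 n g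
  avoids-p1423⇒avoids1423 av a b c d a<b b<c c<d d<n ga<gc gc<gd gd<gb =
    av (contains-by-steps p1423 (zero ∷ suc (suc zero) ∷ suc (suc (suc zero)) ∷ suc zero ∷ [])
          (λ { zero → refl ; (suc zero) → refl ; (suc (suc zero)) → refl ; (suc (suc (suc zero))) → refl })
          (a ∷ b ∷ c ∷ d ∷ []) d<n (λ { zero → a<b ; (suc zero) → b<c ; (suc (suc zero)) → c<d })
          (λ { zero → ga<gc ; (suc zero) → gc<gd ; (suc (suc zero)) → gd<gb }))

  avoids-p4123⇒avoids4123 : Avoids π p4123 → Avoids4123 n g
  avoids-p4123⇒avoids4123 av a b c d a<b b<c c<d d<n gb<gc gc<gd gd<ga =
    av (contains-by-steps p4123 (suc zero ∷ suc (suc zero) ∷ suc (suc (suc zero)) ∷ zero ∷ [])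
          (λ { zero → refl ; (suc zero) → refl ; (suc (suc zero)) → refl ; (suc (suc (suc zero))) → refl })
          (a ∷ b ∷ c ∷ d ∷ []) d<n (λ { zero → a<b ; (suc zero) → b<c ; (suc (suc zero)) → c<d })
          (λ { zero → gb<gc ; (suc zero) → gc<gd ; (suc (suc zero)) → gd<ga }))

  avoids321⇒avoids-p321 : Avoids321 n g → Avoids π p321
  avoids321⇒avoids-p321 av c@(e , increasing , _) =
    av _ _ _ (increasing zero (suc zero) z<s) (increasing (suc zero) (suc (suc zero)) (s<s z<s)) (toℕ<n _)
      (contains-< p321 c (suc (suc zero)) (suc zero) z<s) (contains-< p321 c (suc zero) zero (s<s z<s))

  avoids1423⇒avoids-p1423 : Avoids1423 n g → Avoids π p1423
  avoids1423⇒avoids-p1423 av c@(e , increasing , _) =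
    av _ _ _ _ (increasing zero (suc zero) z<s) (increasing (suc zero) (suc (suc zero)) (s<s z<s))
      (increasing (suc (suc zero)) (suc (suc (suc zero))) (s<s (s<s z<s))) (toℕ<n _)
      (contains-< p1423 c zero (suc (suc zero)) z<s) (contains-< p1423 c (suc (suc zero)) (suc (suc (suc zero))) (s<s z<s))
      (contains-< p1423 c (suc (suc (suc zero))) (suc zero) (s<s (s<s z<s)))

  avoids4123⇒avoids-p4123 : Avoids4123 n g → Avoids π p4123
  avoids4123⇒avoids-p4123 av c@(e , increasing , _) =
    av _ _ _ _ (increasing zero (suc zero) z<s) (increasing (suc zero) (suc (suc zero)) (s<s z<s))
      (increasing (suc (suc zero)) (suc (suc (suc zero))) (s<s (s<s z<s))) (toℕ<n _)
      (contains-< p4123 c (suc zero) (suc (suc zero)) z<s) (contains-< p4123 c (suc (suc zero)) (suc (suc (suc zero))) (s<s z<s))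
      (contains-< p4123 c (suc (suc (suc zero))) zero (s<s (s<s z<s)))

  good⇒goodMap : Good π → GoodMap n g
  good⇒goodMap (perm , fish , av321 , av1423 , av4123) =
    goodMap represents-bounded (isPerm⇒injectiveOn perm) (isFishburn⇒fishburn fish)
      (avoids-p321⇒avoids321 av321) (avoids-p1423⇒avoids1423 av1423) (avoids-p4123⇒avoids4123 av4123)

  goodMap⇒good : GoodMap n g → Good π
  goodMap⇒good (goodMap _ inj fish av321 av1423 av4123) =
    injectiveOn⇒isPerm inj , fishburn⇒isFishburn fish ,
    avoids321⇒avoids-p321 av321 , avoids1423⇒avoids-p1423 av1423 , avoids4123⇒avoids-p4123 av4123

represents-agree : ∀ {N π g g′} → Represents {suc N} π g → Represents π g′ → Agree (suc N) g g′
represents-agree rep rep′ i i<n = trans (sym (represents-at rep i<n)) (represents-at rep′ i<n)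

agree⇒≡ : ∀ {n π π′ g g′} → Represents {n} π g → Represents π′ g′ → Agree n g g′ → π ≡ π′
agree⇒≡ {π = π} {π′} (represents rep) (represents rep′) ag = begin
  π                   ≡⟨ tabulate∘lookup π ⟨
  tabulate (lookup π)  ≡⟨ tabulate-cong (λ i → toℕ-injective (trans (rep i) (trans (ag (toℕ i) (toℕ<n i)) (sym (rep′ i))))) ⟩
  tabulate (lookup π′) ≡⟨ tabulate∘lookup π′ ⟩
  π′                  ∎
  where open ≡-Reasoning

-- Arguments beyond N are sent to the last element; clamp is only applied to values ≤ N.
clamp : ∀ {N} → ℕ → Fin (suc N)
clamp {zero}  _       = zero
clamp {suc N} zero    = zero
clamp {suc N} (suc x) = suc (clamp x)

toℕ-clamp : ∀ {N x} → x ≤ N → toℕ (clamp {N} x) ≡ x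
toℕ-clamp {zero}  z≤n       = refl
toℕ-clamp {suc N} z≤n       = refl
toℕ-clamp {suc N} (s≤s x≤N) = cong suc (toℕ-clamp x≤N)

clamp-toℕ : ∀ {N} (i : Fin (suc N)) → clamp (toℕ i) ≡ i
clamp-toℕ {zero}  zero    = refl
clamp-toℕ {suc N} zero    = refl
clamp-toℕ {suc N} (suc i) = cong suc (clamp-toℕ i)

word : ∀ N → (ℕ → ℕ) → Word (suc N)
word N g = tabulate (λ i → clamp (g (toℕ i)))

represents-word : ∀ {N g} → Bounded (suc N) g → Represents (word N g) g
represents-word {N} {g} bd = represents λ i →
  trans (cong toℕ (lookup∘tabulate (λ j → clamp (g (toℕ j))) i)) (toℕ-clamp (≤-pred (bd (toℕ i) (toℕ<n i))))

valuesOf : ∀ {N} → Word (suc N) → ℕ → ℕ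
valuesOf π x = toℕ (lookup π (clamp x))

represents-valuesOf : ∀ {N} (π : Word (suc N)) → Represents π (valuesOf π)
represents-valuesOf π = represents λ i → cong (toℕ ∘ lookup π) (sym (clamp-toℕ i))

module _ {N : ℕ} where

  represents-decode : (s : Shape (suc N)) → Represents (word N (decode s)) (decode s)
  represents-decode s = represents-word (GoodMap.bounded (goodMap-decode s))

  good-word-decode : (s : Shape (suc N)) → Good (word N (decode s))
  good-word-decode s = goodMap⇒good (represents-decode s) (goodMap-decode s)

  word-decode-injective : ∀ {s s′ : Shape (suc N)} → word N (decode s) ≡ word N (decode s′) → s ≡ s′
  word-decode-injective {s} {s′} eq = decode-injective s s′
    (represents-agree (represents-decode s) (subst (λ π → Represents π (decode s′)) (sym eq) (represents-decode s′)))

  good⇒word-decode : ∀ (π : Word (suc N)) → Good π → ∃ λ (s : Shape (suc N)) → π ≡ word N (decode s)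
  good⇒word-decode π good@(perm , _) with Characterisation.shape (good⇒goodMap rep good) (isPerm⇒surjectiveOn rep perm) z<s
    where rep = represents-valuesOf π
  ... | s , ag = s , agree⇒≡ (represents-valuesOf π) (represents-decode s) ag

theorem3p12 : ∀ (n : ℕ) → n ≥ 1 → HasCount {n} Good (F (suc n) ∸ 1)
theorem3p12 (suc N) _ =
  map (word N ∘ decode) (shapes (suc N)) ,
  map⁺ word-decode-injective (unique-shapes (suc N)) ,
  (λ π → mk⇔ (listed⇒good π) (good⇒listed π)) ,
  trans (length-map _ (shapes (suc N))) (length-shapes N)
  where
  listed⇒good : ∀ π → π ∈ map (word N ∘ decode) (shapes (suc N)) → Good π
  listed⇒good π π∈ with ∈-map⁻ (word N ∘ decode) π∈
  ... | s , _ , refl = good-word-decode s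
  good⇒listed : ∀ π → Good π → π ∈ map (word N ∘ decode) (shapes (suc N))
  good⇒listed π good with good⇒word-decode π good
  ... | s , refl = ∈-map⁺ (word N ∘ decode) (∈-shapes s)
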